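{- Let $G$ be a finite connected graph with at least two vertices and let $x_0\in V(G)$. Then for some integer $m\ge 0$ there exist blocks $B_0,\dots,B_m$ and cutvertices $x_1,\dots,x_m$ of $G$ such that $B_0x_1B_1x_2\cdots x_mB_m$ is a path in the block tree of $G$, $x_0\in V(B_0)$, and $$\sum_{i=0}^m \operatorname{td}(B_i-x_i)\ \ge\ \operatorname{td}(G-x_0).$$
   Context: All graphs are finite and simple. A cutvertex of a connected graph $G$ is a vertex $x$ such that $G-x$ is disconnected. A block of $G$ is a maximal connected subgraph $B\subseteq G$ that has no cutvertex (of $B$ itself). The block tree of $G$ is the tree whose nodes are the cutvertices and the blocks of $G$, in which a cutvertex $x$ and a block $B$ are adjacent iff $x\in V(B)$ (and no other adjacencies). An elimination forest of a graph $H$ is a rooted forest with trees $T_1,\dots,T_p$ such that $V(T_1),\dots,V(T_p)$ partition $V(H)$ and, for every edge $xy\in E(H)$, $x$ and $y$ lie in the same tree and one is an ancestor of the other. Its vertex-height is the maximum number of vertices on a root-to-leaf path in any of its trees. The treedepth $\operatorname{td}(H)$ is the minimum vertex-height of an elimination forest of $H$ (with $\operatorname{td}$ of the empty graph equal to $0$). -}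

module Defs where

open import Data.Nat using (ℕ; zero; suc; _≤_)
open import Data.Bool using (Bool; true; false; T; _∧_; not)
open import Data.Fin using (Fin; _≟_)
open import Data.Maybe using (Maybe; just; nothing)
open import Data.Product using (Σ; ∃; ∃-syntax; _×_)
open import Data.Sum using (_⊎_)
open import Relation.Nullary using (¬_; ⌊_⌋)
open import Relation.Binary.PropositionalEquality using (_≡_; _≢_)

-- A (finite) graph whose vertex set is a subset of Fin n:
-- V v = true iff v is a vertex, E u v = true iff uv is an edge.
record Gr (n : ℕ) : Set where
  constructor mkGr
  field
    V : Fin n → Bool
    E : Fin n → Fin n → Bool
open Gr public

IsSimple : ∀ {n} → Gr n → Set
IsSimple G = (∀ u v → E G u v ≡ E G v u)
           × (∀ u → E G u u ≡ false)
           × (∀ u v → T (E G u v) → T (V G u))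

_─_ : ∀ {n} → Gr n → Fin n → Gr n
H ─ x = mkGr (λ y → V H y ∧ not ⌊ y ≟ x ⌋)
             (λ y z → E H y z ∧ (not ⌊ y ≟ x ⌋ ∧ not ⌊ z ≟ x ⌋))

_⊆G_ : ∀ {n} → Gr n → Gr n → Set
H ⊆G K = (∀ v → T (V H v) → T (V K v)) × (∀ u v → T (E H u v) → T (E K u v))

data Reach {n} (H : Gr n) : Fin n → Fin n → Set where
  here : ∀ {u} → Reach H u u
  step : ∀ {u w v} → T (E H u w) → Reach H w v → Reach H u v

Connected : ∀ {n} → Gr n → Set
Connected H = (∃[ v ] T (V H v))
            × (∀ u v → T (V H u) → T (V H v) → Reach H u v)

Disconnected : ∀ {n} → Gr n → Set
Disconnected H = ∃[ u ] ∃[ v ] (T (V H u) × T (V H v) × ¬ Reach H u v)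

IsCutvertex : ∀ {n} → Gr n → Fin n → Set
IsCutvertex H x = T (V H x) × Disconnected (H ─ x)

HasCutvertex : ∀ {n} → Gr n → Set
HasCutvertex H = ∃[ x ] IsCutvertex H x

IsBlock : ∀ {n} → Gr n → Gr n → Set
IsBlock G B = IsSimple B × B ⊆G G × Connected B × ¬ HasCutvertex B
            × (∀ B′ → IsSimple B′ → B ⊆G B′ → B′ ⊆G G → Connected B′
                    → ¬ HasCutvertex B′ → B′ ⊆G B)

data Anc {n} (par : Fin n → Maybe (Fin n)) : Fin n → Fin n → Set where
  here : ∀ {u} → Anc par u u
  up   : ∀ {u w v} → par v ≡ just w → Anc par u w → Anc par u v

-- An elimination forest of H: a rooted forest on V(H) given by a parent map;
-- depth v = number of vertices on the path from the root to v (its existence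
-- certifies acyclicity).
record ElimForest {n} (H : Gr n) : Set where
  field
    par   : Fin n → Maybe (Fin n)
    depth : Fin n → ℕ
    root-depth : ∀ v → T (V H v) → par v ≡ nothing → depth v ≡ 1
    par-depth  : ∀ v p → T (V H v) → par v ≡ just p
                 → T (V H p) × depth v ≡ suc (depth p)
    edge-anc   : ∀ u v → T (E H u v) → Anc par u v ⊎ Anc par v u
open ElimForest public

HeightAtMost : ∀ {n} {H : Gr n} → ElimForest H → ℕ → Set
HeightAtMost {H = H} F k = ∀ v → T (V H v) → depth F v ≤ k

IsTd : ∀ {n} → Gr n → ℕ → Set
IsTd H t = (Σ (ElimForest H) λ F → HeightAtMost F t)
         × (∀ (F : ElimForest H) k → HeightAtMost F k → t ≤ k)

module Submission where

-- We prove by induction on the number of vertices that G ─ x₀ has an elimination forest F in which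
-- every vertex v has depth at most the total width Σ td(Bᵢ ─ xᵢ) of some path x₀ B₀ x₁ ⋯ Bₘ ∋ v in
-- the block tree; the deepest vertex of F then gives the theorem, as td(G ─ x₀) ≤ height F.
-- Without a cutvertex, G is a block and an optimal forest of G ─ x₀ works with the one-block path.
-- Otherwise G splits at a cutvertex c into two pieces G₁ ∋ x₀ and G₂ meeting only in c. If x₀ = c,
-- forests for G₁ ─ c and G₂ ─ c are placed side by side. If x₀ ≠ c, the forest of G₂ ─ c is hung below
-- c in the forest of G₁ ─ x₀, so that the depth of a vertex v of G₂ is the depth of c plus its depth in
-- G₂ ─ c, and the path from x₀ to c in G₁ followed by the path from c to v in G₂ pays for both.

open import Defs
open import Data.Bool using (Bool; false; T; _∧_; _∨_; not; if_then_else_)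
open import Data.Bool.Properties using (T-∧; T-∨; T-≡; ∧-comm; ¬-not)
open import Data.Empty using (⊥-elim)
open import Data.Fin using (Fin; zero; suc; _≟_; inject₁; toℕ; fromℕ<; finToFun; funToFin)
open import Data.Fin.Properties using (any?; all?; toℕ-fromℕ<; finToFun-funToFin)
open import Data.Fin.Subset using (∣_∣) renaming (_∈_ to _∈ₛ_)
open import Data.Fin.Subset.Properties using (∣p∣≤n; p⊂q⇒∣p∣<∣q∣)
open import Data.List using (List; []; _∷_; _++_; tabulate; allFin)
import Data.List as List
open import Data.List.Extrema.Nat using (argmax; argmax-all; v≤f[argmax]⁺)
open import Data.List.Membership.Propositional.Properties using (∈-lookup; ∈-filter⁺; ∈-allFin)
open import Data.List.Properties using (map-tabulate; tabulate-lookup; map-++)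
open import Data.List.Relation.Unary.All using (All; []; _∷_)
import Data.List.Relation.Unary.All as All
open import Data.List.Relation.Unary.All.Properties using (all-filter)
import Data.List.Relation.Unary.All.Properties as Allₚ
open import Data.List.Relation.Unary.AllPairs using (AllPairs; []; _∷_)
import Data.List.Relation.Unary.AllPairs.Properties as AllPairsₚ
import Data.List.Relation.Unary.Any as Any
open import Data.List.Relation.Unary.Linked using (Linked; [-]; _∷_)
open import Data.Maybe using (Maybe; just; nothing; maybe)
import Data.Maybe.Properties as Maybe
open import Data.Nat using (ℕ; zero; suc; _+_; _≤_; _<_; z≤n; s≤s)
import Data.Nat as ℕ
open import Data.Nat.Induction using (<-wellFounded)
open import Data.Nat.ListAction using (sum)
open import Data.Nat.ListAction.Properties using (sum-++)
open import Data.Nat.Properties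
  using (≤-refl; ≤-reflexive; ≤-trans; ≤-pred; 1+n≰n; n≤0⇒n≡0; ≰⇒>; suc-injective; +-suc; +-comm; +-mono-≤;
         m≤m+n; m⊓n≤n; m≤n⇒m⊓n≡m; module ≤-Reasoning)
open import Data.Product using (Σ; ∃; ∃-syntax; _×_; _,_; proj₁; proj₂)
import Data.Product as Product
open import Data.Sum using (_⊎_; inj₁; inj₂)
import Data.Sum as Sum
import Data.Vec as Vec
open import Data.Vec.Properties using (lookup∘tabulate; []=⇒lookup; lookup⇒[]=)
open import Function using (_∘_; id; case_of_)
open import Function.Bundles using (Equivalence)
open import Induction.WellFounded using (Acc; acc)
open import Relation.Binary.PropositionalEquality
  using (_≡_; _≢_; refl; sym; trans; cong; cong₂; subst; ≢-sym; module ≡-Reasoning)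
open import Relation.Nullary using (¬_; Dec; yes; no; ⌊_⌋)
open import Relation.Nullary.Decidable
  using (T?; map′; decidable-stable; toWitness; fromWitness; toWitnessFalse; fromWitnessFalse;
         _×-dec_; _⊎-dec_; _→-dec_; ¬?)

open Equivalence using (to; from)

private variable
  n : ℕ

-- Induced subgraphs and vertex deletion

induced : Gr n → (Fin n → Bool) → Gr n
induced G s = mkGr (λ y → V G y ∧ s y) (λ y z → E G y z ∧ (s y ∧ s z))

module Induced (G : Gr n) (s : Fin n → Bool) where

  V⁺ : ∀ {y} → T (V G y) → T (s y) → T (V (induced G s) y)
  V⁺ g s = from T-∧ (g , s)

  V⁻ : ∀ {y} → T (V (induced G s) y) → T (V G y) × T (s y)
  V⁻ = to T-∧

  E⁺ : ∀ {y z} → T (E G y z) → T (s y) → T (s z) → T (E (induced G s) y z)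
  E⁺ e sy sz = from T-∧ (e , from T-∧ (sy , sz))

  E⁻ : ∀ {y z} → T (E (induced G s) y z) → T (E G y z) × T (s y) × T (s z)
  E⁻ p = let e , q = to T-∧ p in e , to T-∧ q

induced-simple : ∀ {G : Gr n} s → IsSimple G → IsSimple (induced G s)
induced-simple {G = G} s (sym-E , loopless , ends) = sym-E′ , loopless′ , ends′
  where
  open Induced G s
  sym-E′ : ∀ u v → E (induced G s) u v ≡ E (induced G s) v u
  sym-E′ u v rewrite sym-E u v | ∧-comm (s u) (s v) = refl
  loopless′ : ∀ u → E (induced G s) u u ≡ false
  loopless′ u rewrite loopless u = refl
  ends′ : ∀ u v → T (E (induced G s) u v) → T (V (induced G s) u)
  ends′ u v p = let e , su , _ = E⁻ p in V⁺ (ends u v e) su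

-- H ─ x is by definition the subgraph induced on the vertices other than x.
module Deletion (H : Gr n) (x : Fin n) where

  private
    module I = Induced H (λ y → not ⌊ y ≟ x ⌋)

  V⁺ : ∀ {y} → T (V H y) → y ≢ x → T (V (H ─ x) y)
  V⁺ {y} h y≢x = I.V⁺ h (fromWitnessFalse {a? = y ≟ x} y≢x)

  V⁻ : ∀ {y} → T (V (H ─ x) y) → T (V H y) × y ≢ x
  V⁻ {y} p = let h , q = I.V⁻ p in h , toWitnessFalse {a? = y ≟ x} q

  E⁺ : ∀ {y z} → T (E H y z) → y ≢ x → z ≢ x → T (E (H ─ x) y z)
  E⁺ {y} {z} e y≢x z≢x = I.E⁺ e (fromWitnessFalse {a? = y ≟ x} y≢x) (fromWitnessFalse {a? = z ≟ x} z≢x)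

  E⁻ : ∀ {y z} → T (E (H ─ x) y z) → T (E H y z) × y ≢ x × z ≢ x
  E⁻ {y} {z} p = let e , q , r = I.E⁻ p in e , toWitnessFalse {a? = y ≟ x} q , toWitnessFalse {a? = z ≟ x} r

─-simple : ∀ {G : Gr n} x → IsSimple G → IsSimple (G ─ x)
─-simple x = induced-simple (λ y → not ⌊ y ≟ x ⌋)

EdgesOnVertices : Gr n → Set
EdgesOnVertices H = ∀ u w → T (E H u w) → T (V H u) × T (V H w)

E-Symmetric : Gr n → Set
E-Symmetric H = ∀ u w → T (E H u w) → T (E H w u)

simple⇒E-symmetric : ∀ {G : Gr n} → IsSimple G → E-Symmetric G
simple⇒E-symmetric (sym-E , _) u w e = subst T (sym-E u w) e

simple⇒edgesOnVertices : ∀ {G : Gr n} → IsSimple G → EdgesOnVertices G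
simple⇒edgesOnVertices sG@(_ , _ , ends) u w e = ends u w e , ends w u (simple⇒E-symmetric sG u w e)

-- Reachability

module _ {H : Gr n} where

  reach-trans : ∀ {a b c} → Reach H a b → Reach H b c → Reach H a c
  reach-trans here q = q
  reach-trans (step e p) q = step e (reach-trans p q)

  reach-snoc : ∀ {a b c} → Reach H a b → T (E H b c) → Reach H a c
  reach-snoc p e = reach-trans p (step e here)

  reach-sym : E-Symmetric H → ∀ {a b} → Reach H a b → Reach H b a
  reach-sym sym-E here = here
  reach-sym sym-E (step {u} {w} e p) = reach-snoc (reach-sym sym-E p) (sym-E u w e)

reach-map : ∀ {H K : Gr n} → (∀ u v → T (E H u v) → T (E K u v)) → ∀ {a b} → Reach H a b → Reach K a b
reach-map f here = here
reach-map f (step {u} {w} e p) = step (f u w e) (reach-map f p)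

size : (Fin n → Bool) → ℕ
size f = ∣ Vec.tabulate f ∣

private
  ∈-tabulate⁺ : ∀ {h : Fin n → Bool} {x} → T (h x) → x ∈ₛ Vec.tabulate h
  ∈-tabulate⁺ {h = h} {x} p = lookup⇒[]= x _ (trans (lookup∘tabulate h x) (to T-≡ p))

  ∈-tabulate⁻ : ∀ {h : Fin n → Bool} {x} → x ∈ₛ Vec.tabulate h → T (h x)
  ∈-tabulate⁻ {h = h} {x} p = from T-≡ (trans (sym (lookup∘tabulate h x)) ([]=⇒lookup p))

size-strict : ∀ {f g : Fin n → Bool} → (∀ x → T (f x) → T (g x))
  → ∀ x → T (g x) → ¬ T (f x) → size f < size g
size-strict f⊆g x gx ¬fx =
  p⊂q⇒∣p∣<∣q∣ ((λ y∈f → ∈-tabulate⁺ (f⊆g _ (∈-tabulate⁻ y∈f))) ,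
               x , ∈-tabulate⁺ gx , λ x∈f → ¬fx (∈-tabulate⁻ x∈f))

size≤n : (f : Fin n → Bool) → size f ≤ n
size≤n f = ∣p∣≤n (Vec.tabulate f)

-- Reachability is decided by saturating the ball of vertices at distance ≤ k around u:
-- until it stops growing it gains a vertex per step, so it is closed after n + 1 steps.
module _ (H : Gr n) (u : Fin n) where

  private
    ball : ℕ → Fin n → Bool
    ball zero v = ⌊ v ≟ u ⌋
    ball (suc k) v = ball k v ∨ ⌊ any? (λ w → T? (ball k w ∧ E H w v)) ⌋

    Closed : (Fin n → Bool) → Set
    Closed R = ∀ w v → T (R w) → T (E H w v) → T (R v)

    ball-sound : ∀ k v → T (ball k v) → Reach H u v
    ball-sound zero v p = subst (Reach H u) (sym (toWitness p)) here
    ball-sound (suc k) v p with to T-∨ p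
    ... | inj₁ q = ball-sound k v q
    ... | inj₂ q with toWitness q
    ... | w , r = let uw , e = to T-∧ r in reach-snoc (ball-sound k w uw) e

    ball-step : ∀ k {w v} → T (ball k w) → T (E H w v) → T (ball (suc k) v)
    ball-step k {w} {v} p e = from (T-∨ {ball k v}) (inj₂ (fromWitness (w , from T-∧ (p , e))))

    ball-grows : ∀ k {v} → T (ball k v) → T (ball (suc k) v)
    ball-grows k p = from T-∨ (inj₁ p)

    center∈ball : ∀ k → T (ball k u)
    center∈ball zero = fromWitness refl
    center∈ball (suc k) = ball-grows k (center∈ball k)

    stable⇒closed : ∀ k → (∀ v → T (ball (suc k) v) → T (ball k v)) → Closed (ball (suc k))
    stable⇒closed k stable w v p e = ball-step k (stable w p) e

    closed⇒stable : ∀ k → Closed (ball k) → ∀ v → T (ball (suc k) v) → T (ball k v)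
    closed⇒stable k closed v p with to T-∨ p
    ... | inj₁ q = q
    ... | inj₂ q with toWitness q
    ... | w , r = let uw , e = to T-∧ r in closed w v uw e

    closed-or-large : ∀ k → Closed (ball k) ⊎ k ≤ size (ball k)
    closed-or-large zero = inj₂ z≤n
    closed-or-large (suc k) with closed-or-large k
    ... | inj₁ closed = inj₁ (stable⇒closed k (closed⇒stable k closed))
    ... | inj₂ large with any? (λ v → T? (ball (suc k) v) ×-dec ¬? (T? (ball k v)))
    ... | yes (v , new , ¬old) = inj₂ (≤-trans (s≤s large) (size-strict (λ _ → ball-grows k) v new ¬old))
    ... | no ¬new = inj₁ (stable⇒closed k (λ v p → decidable-stable (T? _) (λ ¬old → ¬new (v , p , ¬old))))

    closed : Closed (ball (suc n))
    closed with closed-or-large (suc n)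
    ... | inj₁ c = c
    ... | inj₂ large = ⊥-elim (1+n≰n (≤-trans large (size≤n _)))

    ball-complete : ∀ {a b} → Reach H a b → T (ball (suc n) a) → T (ball (suc n) b)
    ball-complete here p = p
    ball-complete (step {a} {w} e r) p = ball-complete r (closed a w p e)

  -- Opaque because the sides of a cut are defined through reach?, and unfolding the saturation
  -- during type checking is prohibitively expensive.
  opaque
    reach? : ∀ v → Dec (Reach H u v)
    reach? v = map′ (ball-sound (suc n) v) (λ r → ball-complete r (center∈ball (suc n))) (T? (ball (suc n) v))

-- Elimination forests and the existence of treedepth

module _ {par : Fin n → Maybe (Fin n)} where

  anc-trans : ∀ {u w v} → Anc par u w → Anc par w v → Anc par u v
  anc-trans p here = p
  anc-trans p (up e q) = up e (anc-trans p q)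

module _ {H : Gr n} (F : ElimForest H) where

  anc-transfer : ∀ {par′ : Fin n → Maybe (Fin n)}
    → (∀ {y w} → T (V H y) → par F y ≡ just w → par′ y ≡ just w)
    → ∀ {x y} → Anc (par F) x y → T (V H y) → Anc par′ x y
  anc-transfer agree here _ = here
  anc-transfer agree {y = y} (up {w = w} e a) y∈H =
    up (agree y∈H e) (anc-transfer agree a (proj₁ (par-depth F y w y∈H e)))

  root-above : ∀ v → T (V H v) → ∃[ r ] T (V H r) × par F r ≡ nothing × Anc (par F) r v
  root-above v v∈H = climb (depth F v) v v∈H refl
    where
    climb : ∀ d v → T (V H v) → depth F v ≡ d → ∃[ r ] T (V H r) × par F r ≡ nothing × Anc (par F) r v
    climb d v v∈H dv with par F v in e
    ... | nothing = v , v∈H , e , here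
    ... | just w with par-depth F v w v∈H e | d
    ...   | _ , dv′ | zero = case trans (sym dv′) dv of λ ()
    ...   | w∈H , dv′ | suc d′ =
      let r , r∈H , root , r≤w = climb d′ w w∈H (suc-injective (trans (sym dv′) dv)) in r , r∈H , root , up e r≤w

EdgeSplit : Gr n → Gr n → Maybe (Fin n) → Fin n → Fin n → Set
EdgeSplit H₁ H₂ anchor u w =
  T (E H₁ u w) ⊎ T (E H₂ u w) ⊎ (anchor ≡ just u × T (V H₂ w)) ⊎ (anchor ≡ just w × T (V H₂ u))

-- The forest F₂ is hung below the anchor, or placed beside F₁ when there is no anchor.
module Graft {H H₁ H₂ : Gr n} (F₁ : ElimForest H₁) (F₂ : ElimForest H₂)
  (ends₁ : EdgesOnVertices H₁) (ends₂ : EdgesOnVertices H₂)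
  (V₁⊆V : ∀ {y} → T (V H₁ y) → T (V H y))
  (V₂⊆V∖V₁ : ∀ {y} → T (V H₂ y) → T (V H y) × ¬ T (V H₁ y))
  (V∖V₁⊆V₂ : ∀ {y} → T (V H y) → ¬ T (V H₁ y) → T (V H₂ y))
  (anchor : Maybe (Fin n)) (anchor∈H₁ : ∀ {a} → anchor ≡ just a → T (V H₁ a))
  (edges : ∀ u w → T (E H u w) → EdgeSplit H₁ H₂ anchor u w)
  where

  open ≡-Reasoning

  private
    reparent : Maybe (Fin n) → Maybe (Fin n)
    reparent nothing = anchor
    reparent (just w) = just w

    parent : Fin n → Maybe (Fin n)
    parent v = if V H₁ v then par F₁ v else reparent (par F₂ v)

    depth′ : Fin n → ℕ
    depth′ v = if V H₁ v then depth F₁ v else maybe (depth F₁) 0 anchor + depth F₂ v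

    parent₁ : ∀ {v} → T (V H₁ v) → parent v ≡ par F₁ v
    parent₁ v∈₁ rewrite to T-≡ v∈₁ = refl

    parent₂ : ∀ {v} → ¬ T (V H₁ v) → parent v ≡ reparent (par F₂ v)
    parent₂ v∉₁ rewrite ¬-not (v∉₁ ∘ from T-≡) = refl

    depth₁ : ∀ {v} → T (V H₁ v) → depth′ v ≡ depth F₁ v
    depth₁ v∈₁ rewrite to T-≡ v∈₁ = refl

    depth₂ : ∀ {v} → ¬ T (V H₁ v) → depth′ v ≡ maybe (depth F₁) 0 anchor + depth F₂ v
    depth₂ v∉₁ rewrite ¬-not (v∉₁ ∘ from T-≡) = refl

    ∉₁ : ∀ {v} → T (V H₂ v) → ¬ T (V H₁ v)
    ∉₁ = proj₂ ∘ V₂⊆V∖V₁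

    root : ∀ v → T (V H v) → parent v ≡ nothing → depth′ v ≡ 1
    root v v∈ pv with T? (V H₁ v)
    ... | yes v∈₁ = trans (depth₁ v∈₁) (root-depth F₁ v v∈₁ (trans (sym (parent₁ v∈₁)) pv))
    ... | no v∉₁ = trans (depth₂ v∉₁) (reparented-root (par F₂ v) refl (trans (sym (parent₂ v∉₁)) pv))
      where
      reparented-root : ∀ m → par F₂ v ≡ m → reparent m ≡ nothing → maybe (depth F₁) 0 anchor + depth F₂ v ≡ 1
      reparented-root nothing e no-anchor =
        cong₂ _+_ (cong (maybe (depth F₁) 0) no-anchor) (root-depth F₂ v (V∖V₁⊆V₂ v∈ v∉₁) e)

    step₂ : ∀ {v q} → T (V H₂ v) → ∀ m → par F₂ v ≡ m → reparent m ≡ just q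
      → T (V H q) × depth′ v ≡ suc (depth′ q)
    step₂ {v} {q} v∈₂ (just w) e refl =
      let q∈₂ , dv = par-depth F₂ v q v∈₂ e in
      proj₁ (V₂⊆V∖V₁ q∈₂) ,
      (begin
        depth′ v                                         ≡⟨ depth₂ (∉₁ v∈₂) ⟩
        maybe (depth F₁) 0 anchor + depth F₂ v          ≡⟨ cong (maybe (depth F₁) 0 anchor +_) dv ⟩
        maybe (depth F₁) 0 anchor + suc (depth F₂ q)    ≡⟨ +-suc (maybe (depth F₁) 0 anchor) (depth F₂ q) ⟩
        suc (maybe (depth F₁) 0 anchor + depth F₂ q)    ≡⟨ cong suc (sym (depth₂ (∉₁ q∈₂))) ⟩
        suc (depth′ q)                                   ∎)
    step₂ {v} {q} v∈₂ nothing e anchored =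
      V₁⊆V q∈₁ ,
      (begin
        depth′ v                                   ≡⟨ depth₂ (∉₁ v∈₂) ⟩
        maybe (depth F₁) 0 anchor + depth F₂ v    ≡⟨ cong₂ _+_ (cong (maybe (depth F₁) 0) anchored) (root-depth F₂ v v∈₂ e) ⟩
        depth F₁ q + 1                             ≡⟨ +-comm (depth F₁ q) 1 ⟩
        suc (depth F₁ q)                           ≡⟨ cong suc (sym (depth₁ q∈₁)) ⟩
        suc (depth′ q)                             ∎)
      where q∈₁ = anchor∈H₁ anchored

    parent-step : ∀ v q → T (V H v) → parent v ≡ just q → T (V H q) × depth′ v ≡ suc (depth′ q)
    parent-step v q v∈ pv with T? (V H₁ v)
    ... | yes v∈₁ =
      let q∈₁ , dv = par-depth F₁ v q v∈₁ (trans (sym (parent₁ v∈₁)) pv) in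
      V₁⊆V q∈₁ , trans (depth₁ v∈₁) (trans dv (cong suc (sym (depth₁ q∈₁))))
    ... | no v∉₁ = step₂ (V∖V₁⊆V₂ v∈ v∉₁) (par F₂ v) refl (trans (sym (parent₂ v∉₁)) pv)

    anc₁ : ∀ {x y} → Anc (par F₁) x y → T (V H₁ y) → Anc parent x y
    anc₁ = anc-transfer F₁ (λ y∈₁ e → trans (parent₁ y∈₁) e)

    anc₂ : ∀ {x y} → Anc (par F₂) x y → T (V H₂ y) → Anc parent x y
    anc₂ = anc-transfer F₂ (λ y∈₂ e → trans (parent₂ (∉₁ y∈₂)) (cong reparent e))

    anchor-anc : ∀ {a v} → anchor ≡ just a → T (V H₂ v) → Anc parent a v
    anchor-anc anchored v∈₂ =
      let r , r∈₂ , r-root , r≤v = root-above F₂ _ v∈₂ in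
      anc-trans (up (trans (parent₂ (∉₁ r∈₂)) (trans (cong reparent r-root) anchored)) here) (anc₂ r≤v v∈₂)

    edge : ∀ u w → T (E H u w) → Anc parent u w ⊎ Anc parent w u
    edge u w e with edges u w e
    ... | inj₁ e₁ =
      Sum.map (λ a → anc₁ a (proj₂ (ends₁ u w e₁))) (λ a → anc₁ a (proj₁ (ends₁ u w e₁))) (edge-anc F₁ u w e₁)
    ... | inj₂ (inj₁ e₂) =
      Sum.map (λ a → anc₂ a (proj₂ (ends₂ u w e₂))) (λ a → anc₂ a (proj₁ (ends₂ u w e₂))) (edge-anc F₂ u w e₂)
    ... | inj₂ (inj₂ (inj₁ (anchored , w∈₂))) = inj₁ (anchor-anc anchored w∈₂)
    ... | inj₂ (inj₂ (inj₂ (anchored , u∈₂))) = inj₂ (anchor-anc anchored u∈₂)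

  forest : ElimForest H
  forest = record { par = parent ; depth = depth′ ; root-depth = root ; par-depth = parent-step ; edge-anc = edge }

  depth-on₁ : ∀ {v} → T (V H₁ v) → depth forest v ≡ depth F₁ v
  depth-on₁ = depth₁

  depth-on₂ : ∀ {v} → T (V H₂ v) → depth forest v ≡ maybe (depth F₁) 0 anchor + depth F₂ v
  depth-on₂ = depth₂ ∘ ∉₁

induced-edgesOnVertices : ∀ {G : Gr n} s → EdgesOnVertices G → EdgesOnVertices (induced G s)
induced-edgesOnVertices {G = G} s ends u w e =
  let e′ , su , sw = E⁻ e
      u∈ , w∈ = ends u w e′
  in V⁺ u∈ su , V⁺ w∈ sw
  where open Induced G s

flatForest : (H : Gr n) → (∀ u w → T (E H u w) → u ≡ w) → ElimForest H
flatForest H loops = record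
  { par = λ _ → nothing ; depth = λ _ → 1 ; root-depth = λ _ _ _ → refl ; par-depth = λ _ _ _ ()
  ; edge-anc = λ u w e → inj₁ (subst (Anc _ u) (loops u w e) here) }

HasForestOfHeight : Gr n → ℕ → Set
HasForestOfHeight H k = Σ (ElimForest H) λ F → HeightAtMost F k

-- Some forest exists: put any vertex x above a forest of H ─ x.
forest-exists : (H : Gr n) → EdgesOnVertices H → Acc _<_ (size (V H)) → ∃ (HasForestOfHeight H)
forest-exists H ends (acc smaller) with any? (λ x → T? (V H x))
... | no empty =
  0 , flatForest H (λ u w e → ⊥-elim (empty (u , proj₁ (ends u w e)))) , λ v v∈ → ⊥-elim (empty (v , v∈))
... | yes (x , x∈H) = suc k , G.forest , height
  where
  module D = Deletion H x
  module S = Induced H (λ y → ⌊ y ≟ x ⌋)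

  single : Gr _
  single = induced H (λ y → ⌊ y ≟ x ⌋)

  single⁻ : ∀ {y} → T (V single y) → y ≡ x
  single⁻ p = toWitness (proj₂ (S.V⁻ p))

  single-or-rest : ∀ {y} → T (V H y) → ¬ T (V single y) → T (V (H ─ x) y)
  single-or-rest y∈ y∉ = D.V⁺ y∈ (λ { refl → y∉ (S.V⁺ y∈ (fromWitness refl)) })

  rest = forest-exists (H ─ x) (induced-edgesOnVertices _ ends)
           (smaller (size-strict (λ _ → proj₁ ∘ D.V⁻) x x∈H (λ x∈ → proj₂ (D.V⁻ x∈) refl)))
  k = proj₁ rest
  F₂ = proj₁ (proj₂ rest)

  edges : ∀ u w → T (E H u w) → EdgeSplit single (H ─ x) (just x) u w
  edges u w e = classify (u ≟ x) (w ≟ x)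
    where
    classify : Dec (u ≡ x) → Dec (w ≡ x) → EdgeSplit single (H ─ x) (just x) u w
    classify (yes refl) (yes refl) = inj₁ (S.E⁺ e (fromWitness refl) (fromWitness refl))
    classify (yes refl) (no w≢x) = inj₂ (inj₂ (inj₁ (refl , D.V⁺ (proj₂ (ends u w e)) w≢x)))
    classify (no u≢x) (yes refl) = inj₂ (inj₂ (inj₂ (refl , D.V⁺ (proj₁ (ends u w e)) u≢x)))
    classify (no u≢x) (no w≢x) = inj₂ (inj₁ (D.E⁺ e u≢x w≢x))

  single-loops : ∀ u w → T (E single u w) → u ≡ w
  single-loops u w e = let _ , u∈ , w∈ = S.E⁻ e in trans (toWitness u∈) (sym (toWitness w∈))

  rest⊆H∖single : ∀ {y} → T (V (H ─ x) y) → T (V H y) × ¬ T (V single y)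
  rest⊆H∖single y∈ = proj₁ (D.V⁻ y∈) , λ y∈₁ → proj₂ (D.V⁻ y∈) (single⁻ y∈₁)

  x∈single : ∀ {a} → just x ≡ just a → T (V single a)
  x∈single refl = S.V⁺ x∈H (fromWitness refl)

  module G = Graft (flatForest single single-loops) F₂ (induced-edgesOnVertices _ ends) (induced-edgesOnVertices _ ends)
    (proj₁ ∘ S.V⁻) rest⊆H∖single single-or-rest (just x) x∈single edges

  height : HeightAtMost G.forest (suc k)
  height v v∈ with T? (V single v)
  ... | yes v∈₁ = ≤-trans (≤-reflexive (G.depth-on₁ v∈₁)) (s≤s z≤n)
  ... | no v∉₁ = let v∈₂ = single-or-rest v∈ v∉₁ in
                 ≤-trans (≤-reflexive (G.depth-on₂ v∈₂)) (s≤s (proj₂ (proj₂ rest) v v∈₂))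

-- Unlike Anc, ancestry through at most i parent links is decidable.
AncWithin : (Fin n → Maybe (Fin n)) → ℕ → Fin n → Fin n → Set
AncWithin par zero u v = u ≡ v
AncWithin par (suc i) u v = u ≡ v ⊎ ∃[ w ] par v ≡ just w × AncWithin par i u w

module _ {par : Fin n → Maybe (Fin n)} where

  ancWithin? : ∀ i u v → Dec (AncWithin par i u v)
  ancWithin? zero u v = u ≟ v
  ancWithin? (suc i) u v = u ≟ v ⊎-dec any? (λ w → Maybe.≡-dec _≟_ (par v) (just w) ×-dec ancWithin? i u w)

  ancWithin⇒anc : ∀ i {u v} → AncWithin par i u v → Anc par u v
  ancWithin⇒anc zero refl = here
  ancWithin⇒anc (suc i) (inj₁ refl) = here
  ancWithin⇒anc (suc i) (inj₂ (w , e , a)) = up e (ancWithin⇒anc i a)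

  ancWithin-resp : ∀ {par′} → (∀ v → par v ≡ par′ v) → ∀ i {u v} → AncWithin par i u v → AncWithin par′ i u v
  ancWithin-resp same zero a = a
  ancWithin-resp same (suc i) (inj₁ u≡v) = inj₁ u≡v
  ancWithin-resp same (suc i) (inj₂ (w , e , a)) = inj₂ (w , trans (sym (same _)) e , ancWithin-resp same i a)

anc⇒ancWithin : ∀ {H : Gr n} (F : ElimForest H) i {u v} → Anc (par F) u v → T (V H v) → depth F v ≤ i
  → AncWithin (par F) i u v
anc⇒ancWithin F zero here v∈ d≤i = refl
anc⇒ancWithin F (suc i) here v∈ d≤i = inj₁ refl
anc⇒ancWithin F zero {v = v} (up {w = w} e a) v∈ d≤0 =
  case trans (sym (proj₂ (par-depth F v w v∈ e))) (n≤0⇒n≡0 d≤0) of λ ()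
anc⇒ancWithin F (suc i) {v = v} (up {w = w} e a) v∈ d≤i =
  let w∈ , dv = par-depth F v w v∈ e in inj₂ (w , e , anc⇒ancWithin F i a w∈ (≤-pred (subst (_≤ suc i) dv d≤i)))

-- The axioms of an elimination forest of height ≤ k for a given parent map and depth function,
-- with ancestry bounded by k so that they become decidable.
BoundedForest : Gr n → ℕ → (Fin n → Maybe (Fin n)) → (Fin n → ℕ) → Set
BoundedForest H k par d =
    (∀ v → T (V H v) → par v ≡ nothing → d v ≡ 1)
  × (∀ v p → T (V H v) → par v ≡ just p → T (V H p) × d v ≡ suc (d p))
  × (∀ u w → T (E H u w) → AncWithin par k u w ⊎ AncWithin par k w u)
  × (∀ v → T (V H v) → d v ≤ k)

module _ {H : Gr n} {k : ℕ} where

  boundedForest? : ∀ par d → Dec (BoundedForest H k par d)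
  boundedForest? par d =
        all? (λ v → T? (V H v) →-dec Maybe.≡-dec _≟_ (par v) nothing →-dec d v ℕ.≟ 1)
    ×-dec all? (λ v → all? (λ p → T? (V H v) →-dec Maybe.≡-dec _≟_ (par v) (just p)
                                  →-dec (T? (V H p) ×-dec d v ℕ.≟ suc (d p))))
    ×-dec all? (λ u → all? (λ w → T? (E H u w) →-dec (ancWithin? k u w ⊎-dec ancWithin? k w u)))
    ×-dec all? (λ v → T? (V H v) →-dec d v ℕ.≤? k)

  boundedForest⇒forest : ∀ {par d} → BoundedForest H k par d → HasForestOfHeight H k
  boundedForest⇒forest {par} {d} (root , parent , edge , height) =
    record { par = par ; depth = d ; root-depth = root ; par-depth = parent
           ; edge-anc = λ u w e → Sum.map (ancWithin⇒anc k) (ancWithin⇒anc k) (edge u w e) } ,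
    height

  forest⇒boundedForest : EdgesOnVertices H → (F : ElimForest H) → HeightAtMost F k → BoundedForest H k (par F) (depth F)
  forest⇒boundedForest ends F h = root-depth F , par-depth F , edge , h
    where
    edge : ∀ u w → T (E H u w) → AncWithin (par F) k u w ⊎ AncWithin (par F) k w u
    edge u w e = let u∈ , w∈ = ends u w e in
      Sum.map (λ a → anc⇒ancWithin F k a w∈ (h w w∈)) (λ a → anc⇒ancWithin F k a u∈ (h u u∈)) (edge-anc F u w e)

  boundedForest-resp : ∀ {par par′ d d′} → (∀ v → par v ≡ par′ v) → (∀ v → T (V H v) → d v ≡ d′ v)
    → BoundedForest H k par d → BoundedForest H k par′ d′
  boundedForest-resp same-par same-d (root , parent , edge , height) =
    (λ v v∈ e → trans (sym (same-d v v∈)) (root v v∈ (trans (same-par v) e))) ,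
    (λ v p v∈ e → let p∈ , dv = parent v p v∈ (trans (same-par v) e) in
                  p∈ , trans (sym (same-d v v∈)) (trans dv (cong suc (same-d p p∈)))) ,
    (λ u w e → Sum.map (ancWithin-resp same-par k) (ancWithin-resp same-par k) (edge u w e)) ,
    (λ v v∈ → subst (_≤ k) (same-d v v∈) (height v v∈))

-- A forest of height ≤ k is described by a parent code in Fin (1 + n) and a depth in Fin (1 + k)
-- for every vertex; there are finitely many such descriptions.
private
  decodeParent : Fin (suc n) → Maybe (Fin n)
  decodeParent zero = nothing
  decodeParent (suc i) = just i

  encodeParent : Maybe (Fin n) → Fin (suc n)
  encodeParent nothing = zero
  encodeParent (just i) = suc i

  decode-encode : ∀ (m : Maybe (Fin n)) → decodeParent (encodeParent m) ≡ m
  decode-encode nothing = refl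
  decode-encode (just i) = refl

  truncate : ∀ k → ℕ → Fin (suc k)
  truncate k d = fromℕ< (s≤s (m⊓n≤n d k))

  toℕ-truncate : ∀ {k d} → d ≤ k → toℕ (truncate k d) ≡ d
  toℕ-truncate {k} {d} d≤k = trans (toℕ-fromℕ< (s≤s (m⊓n≤n d k))) (m≤n⇒m⊓n≡m d≤k)

hasForestOfHeight? : (H : Gr n) → EdgesOnVertices H → ∀ k → Dec (HasForestOfHeight H k)
hasForestOfHeight? H ends k =
  map′ (λ (_ , _ , b) → boundedForest⇒forest b) describe
       (any? λ pc → any? λ dc → boundedForest? (decodeParent ∘ finToFun pc) (toℕ ∘ finToFun dc))
  where
  describe : HasForestOfHeight H k
    → ∃[ pc ] ∃[ dc ] BoundedForest H k (decodeParent ∘ finToFun pc) (toℕ ∘ finToFun dc)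
  describe (F , h) =
    funToFin (encodeParent ∘ par F) , funToFin (truncate k ∘ depth F) ,
    boundedForest-resp
      (λ v → sym (trans (cong decodeParent (finToFun-funToFin _ v)) (decode-encode (par F v))))
      (λ v v∈ → sym (trans (cong toℕ (finToFun-funToFin _ v)) (toℕ-truncate (h v v∈))))
      (forest⇒boundedForest ends F h)

least-satisfying : {P : ℕ → Set} → (∀ k → Dec (P k)) → (∀ {i j} → i ≤ j → P i → P j)
  → ∀ {k} → P k → ∃[ t ] P t × (∀ {j} → P j → t ≤ j)
least-satisfying P? upward {zero} p = 0 , p , λ _ → z≤n
least-satisfying P? upward {suc k} p with P? k
... | yes q = least-satisfying P? upward q
... | no ¬q = suc k , p , λ pj → ≰⇒> (λ j≤k → ¬q (upward j≤k pj))

treedepth-exists : (H : Gr n) → EdgesOnVertices H → ∃ (IsTd H)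
treedepth-exists H ends =
  let _ , some = forest-exists H ends (<-wellFounded _)
      t , optimal , least = least-satisfying (hasForestOfHeight? H ends) raise some
  in t , optimal , λ F k h → least (F , h)
  where
  raise : ∀ {i j} → i ≤ j → HasForestOfHeight H i → HasForestOfHeight H j
  raise i≤j (F , h) = F , λ v v∈ → ≤-trans (h v v∈) i≤j

-- Blocks and the pieces of a graph at a cutvertex

-- If B were the single vertex b, the edge bw would form a strictly larger subgraph without cutvertex.
module _ {G : Gr n} (sG : IsSimple G) {b w : Fin n} (bw : T (E G b w)) where

  private
    pair : Fin n → Bool
    pair y = ⌊ y ≟ b ⌋ ∨ ⌊ y ≟ w ⌋

    K : Gr n
    K = induced G pair

    open Induced G pair

    pair-b : T (pair b)
    pair-b = from (T-∨ {⌊ b ≟ b ⌋}) (inj₁ (fromWitness {a? = b ≟ b} refl))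

    pair-w : T (pair w)
    pair-w = from (T-∨ {⌊ w ≟ b ⌋}) (inj₂ (fromWitness {a? = w ≟ w} refl))

    pair⁻ : ∀ {y} → T (pair y) → y ≡ b ⊎ y ≡ w
    pair⁻ {y} p = Sum.map (toWitness {a? = y ≟ b}) (toWitness {a? = y ≟ w}) (to (T-∨ {⌊ y ≟ b ⌋}) p)

    b≢w : b ≢ w
    b≢w refl = subst T (proj₁ (proj₂ sG) b) bw

    wb : T (E G w b)
    wb = simple⇒E-symmetric sG b w bw

    b∈K : T (V K b)
    b∈K = V⁺ (proj₁ (simple⇒edgesOnVertices sG b w bw)) pair-b

    w∈K : T (V K w)
    w∈K = V⁺ (proj₂ (simple⇒edgesOnVertices sG b w bw)) pair-w

    bw∈K : T (E K b w)
    bw∈K = E⁺ bw pair-b pair-w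

    wb∈K : T (E K w b)
    wb∈K = E⁺ wb pair-w pair-b

    endpoint : ∀ {y} → T (V K y) → y ≡ b ⊎ y ≡ w
    endpoint y∈ = pair⁻ (proj₂ (V⁻ y∈))

    K-connected : Connected K
    K-connected = (b , b∈K) , λ y z y∈ z∈ → walk (endpoint y∈) (endpoint z∈)
      where
      walk : ∀ {y z} → y ≡ b ⊎ y ≡ w → z ≡ b ⊎ z ≡ w → Reach K y z
      walk (inj₁ refl) (inj₁ refl) = here
      walk (inj₁ refl) (inj₂ refl) = step bw∈K here
      walk (inj₂ refl) (inj₁ refl) = step wb∈K here
      walk (inj₂ refl) (inj₂ refl) = here

    K-no-cutvertex : ¬ HasCutvertex K
    K-no-cutvertex (x , x∈ , u , v , u∈ , v∈ , ¬uv) =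
      let u∈K , u≢x = Deletion.V⁻ K x u∈
          v∈K , v≢x = Deletion.V⁻ K x v∈
      in ¬uv (subst (Reach (K ─ x) u) (same (endpoint x∈) (endpoint u∈K) (endpoint v∈K) u≢x v≢x) here)
      where
      same : ∀ {x u v} → x ≡ b ⊎ x ≡ w → u ≡ b ⊎ u ≡ w → v ≡ b ⊎ v ≡ w → u ≢ x → v ≢ x → u ≡ v
      same _ (inj₁ refl) (inj₁ refl) _ _ = refl
      same _ (inj₂ refl) (inj₂ refl) _ _ = refl
      same (inj₁ refl) (inj₁ refl) (inj₂ refl) u≢x _ = ⊥-elim (u≢x refl)
      same (inj₂ refl) (inj₁ refl) (inj₂ refl) _ v≢x = ⊥-elim (v≢x refl)
      same (inj₁ refl) (inj₂ refl) (inj₁ refl) _ v≢x = ⊥-elim (v≢x refl)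
      same (inj₂ refl) (inj₂ refl) (inj₁ refl) u≢x _ = ⊥-elim (u≢x refl)

  block-has-second-vertex : ∀ {B} → IsBlock G B → T (V B b) → ∃[ y ] T (V B y) × y ≢ b
  block-has-second-vertex {B} (sB , _ , _ , _ , maximal) b∈B with any? (λ y → T? (V B y) ×-dec ¬? (y ≟ b))
  ... | yes other = other
  ... | no ¬other = ⊥-elim (b≢w (sym (only-b (proj₁ K⊆B w w∈K))))
    where
    only-b : ∀ {y} → T (V B y) → y ≡ b
    only-b {y} y∈ = decidable-stable (y ≟ b) (λ y≢b → ¬other (y , y∈ , y≢b))

    B⊆K : B ⊆G K
    B⊆K = (λ y y∈ → subst (T ∘ V K) (sym (only-b y∈)) b∈K) , no-edge
      where
      no-edge : ∀ y z → T (E B y z) → T (E K y z)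
      no-edge y z e with simple⇒edgesOnVertices sB y z e
      ... | y∈ , z∈ with only-b y∈ | only-b z∈
      ... | refl | refl = ⊥-elim (subst T (proj₁ (proj₂ sB) y) e)

    K⊆B : K ⊆G B
    K⊆B = maximal K (induced-simple pair sG) B⊆K ((λ _ → proj₁ ∘ V⁻) , λ _ _ → proj₁ ∘ E⁻)
                  K-connected K-no-cutvertex

block-has-vertex-≢ : ∀ {G B : Gr n} → IsSimple G → Connected G → IsBlock G B
  → ∀ {c} → (∃[ y ] T (V G y) × y ≢ c) → ∃[ y ] T (V B y) × y ≢ c
block-has-vertex-≢ {B = B} sG cG blockB@(_ , B⊆G , ((b , b∈B) , _) , _) {c} (y , y∈G , y≢c) with b ≟ c
... | no b≢c = b , b∈B , b≢c
... | yes refl with proj₂ cG b y (proj₁ B⊆G b b∈B) y∈G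
...   | here = ⊥-elim (y≢c refl)
...   | step bw _ = block-has-second-vertex sG bw blockB b∈B

-- The hypotheses say that every edge of K crossing the boundary of s has its end in s at c.
reach-into : ∀ {K K′ : Gr n} (s : Fin n → Bool) (c : Fin n)
  → (∀ a w → T (E K a w) → T (s a) → T (s w) → T (E K′ a w))
  → (∀ a w → T (E K a w) → T (s a) → ¬ T (s w) → a ≡ c)
  → (∀ a w → T (E K a w) → ¬ T (s a) → T (s w) → w ≡ c)
  → ∀ {a b} → Reach K a b → T (s b) → (T (s a) → Reach K′ a b) × (¬ T (s a) → Reach K′ c b)
reach-into s c inside leaves enters here sb = (λ _ → here) , (λ ¬sb → ⊥-elim (¬sb sb))
reach-into {K′ = K′} s c inside leaves enters {a} (step {w = w} e r) sb
  with reach-into s c inside leaves enters r sb | T? (s w)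
... | from-w , _ | yes sw =
  (λ sa → step (inside a w e sa sw) (from-w sw)) ,
  (λ ¬sa → subst (λ z → Reach K′ z _) (enters a w e ¬sa sw) (from-w sw))
... | _ , from-c | no ¬sw =
  (λ sa → subst (λ z → Reach K′ z _) (sym (leaves a w e sa ¬sw)) (from-c ¬sw)) , (λ _ → from-c ¬sw)

module Piece {G : Gr n} (sG : IsSimple G) (cG : Connected G) {c : Fin n} (c∈G : T (V G c))
  (s : Fin n → Bool) (c∈s : T (s c))
  (closed : ∀ {y z} → Reach (G ─ c) y z → T (s y) → T (s z))
  (other : ∃[ y ] T (V G y) × T (s y) × y ≢ c)
  where

  piece : Gr n
  piece = induced G s

  open Induced G s public

  piece-simple : IsSimple piece
  piece-simple = induced-simple s sG

  module _ {x : Fin n} where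

    piece-─⁺ : ∀ {y} → T (V G y) → T (s y) → y ≢ x → T (V (piece ─ x) y)
    piece-─⁺ y∈ sy y≢x = Deletion.V⁺ piece x (V⁺ y∈ sy) y≢x

    piece-─⁻ : ∀ {y} → T (V (piece ─ x) y) → T (V G y) × T (s y) × y ≢ x
    piece-─⁻ y∈ = let y∈piece , y≢x = Deletion.V⁻ piece x y∈
                      y∈G , sy = V⁻ y∈piece
                  in y∈G , sy , y≢x

    piece-─-E⁺ : ∀ {y z} → T (E G y z) → T (s y) → T (s z) → y ≢ x → z ≢ x → T (E (piece ─ x) y z)
    piece-─-E⁺ e sy sz y≢x z≢x = Deletion.E⁺ piece x (E⁺ e sy sz) y≢x z≢x

  leaves-at-c : ∀ a w → T (E G a w) → T (s a) → ¬ T (s w) → a ≡ c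
  leaves-at-c a w e sa ¬sw with a ≟ c | w ≟ c
  ... | yes a≡c | _ = a≡c
  ... | no _ | yes refl = ⊥-elim (¬sw c∈s)
  ... | no a≢c | no w≢c = ⊥-elim (¬sw (closed (step (Deletion.E⁺ G c e a≢c w≢c) here) sa))

  enters-at-c : ∀ a w → T (E G a w) → ¬ T (s a) → T (s w) → w ≡ c
  enters-at-c a w e ¬sa sw = leaves-at-c w a (simple⇒E-symmetric sG a w e) sw ¬sa

  c∈piece : T (V piece c)
  c∈piece = V⁺ c∈G c∈s

  piece-connected : Connected piece
  piece-connected = (c , c∈piece) , λ y z y∈ z∈ →
    reach-trans (to-c y∈) (reach-sym (simple⇒E-symmetric piece-simple) (to-c z∈))
    where
    to-c : ∀ {y} → T (V piece y) → Reach piece y c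
    to-c y∈ = let y∈G , sy = V⁻ y∈ in
      proj₁ (reach-into s c (λ a w e → E⁺ e) leaves-at-c enters-at-c (proj₂ cG _ c y∈G c∈G) c∈s) sy

  cutvertex-lift : ∀ {x} → IsCutvertex piece x → IsCutvertex G x
  cutvertex-lift {x} (x∈ , u , v , u∈ , v∈ , ¬uv) =
    let u∈G , su , u≢x = piece-─⁻ u∈
        v∈G , sv , v≢x = piece-─⁻ v∈
    in proj₁ (V⁻ x∈) , u , v , Deletion.V⁺ G x u∈G u≢x , Deletion.V⁺ G x v∈G v≢x ,
       λ uv → ¬uv (proj₁ (reach-into s c inside (λ a w → leaves-at-c a w ∘ proj₁ ∘ Deletion.E⁻ G x)
                                              (λ a w → enters-at-c a w ∘ proj₁ ∘ Deletion.E⁻ G x) uv sv) su)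
    where
    inside : ∀ a w → T (E (G ─ x) a w) → T (s a) → T (s w) → T (E (piece ─ x) a w)
    inside a w e sa sw = let e′ , a≢x , w≢x = Deletion.E⁻ G x e in piece-─-E⁺ e′ sa sw a≢x w≢x

  -- A vertex of B′ outside s would be separated from b by c, making c a cutvertex of B′.
  biconnected⊆piece : ∀ {B′} → IsSimple B′ → B′ ⊆G G → Connected B′ → ¬ HasCutvertex B′
    → ∀ {b} → T (V B′ b) → T (s b) → b ≢ c → B′ ⊆G piece
  biconnected⊆piece {B′} sB′ B′⊆G cB′ ncB′ {b} b∈B′ sb b≢c =
    (λ y y∈ → V⁺ (proj₁ B′⊆G y y∈) (in-s y∈)) ,
    (λ y z e → let y∈ , z∈ = simple⇒edgesOnVertices sB′ y z e in E⁺ (proj₂ B′⊆G y z e) (in-s y∈) (in-s z∈))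
    where
    B′-c⊆G-c : ∀ u v → T (E (B′ ─ c) u v) → T (E (G ─ c) u v)
    B′-c⊆G-c u v e = let e′ , u≢c , v≢c = Deletion.E⁻ B′ c e in
      Deletion.E⁺ G c (proj₂ B′⊆G u v e′) u≢c v≢c

    avoid-c : ¬ T (V B′ c) → ∀ u v → T (E B′ u v) → T (E (G ─ c) u v)
    avoid-c c∉ u v e = let u∈ , v∈ = simple⇒edgesOnVertices sB′ u v e in
      Deletion.E⁺ G c (proj₂ B′⊆G u v e) (λ { refl → c∉ u∈ }) (λ { refl → c∉ v∈ })

    in-s : ∀ {y} → T (V B′ y) → T (s y)
    in-s {y} y∈ = decidable-stable (T? (s y)) λ ¬sy → case T? (V B′ c) of λ where
      (yes c∈) → ncB′ (c , c∈ , b , y , Deletion.V⁺ B′ c b∈B′ b≢c ,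
                       Deletion.V⁺ B′ c y∈ (λ { refl → ¬sy c∈s }) ,
                       λ r → ¬sy (closed (reach-map B′-c⊆G-c r) sb))
      (no c∉) → ¬sy (closed (reach-map (avoid-c c∉) (proj₂ cB′ b y b∈B′ y∈)) sb)

  block-lift : ∀ {B} → IsBlock piece B → IsBlock G B
  block-lift {B} blockB@(sB , B⊆piece , cB , ncB , maximal) =
    sB , B⊆G , cB , ncB , λ B′ sB′ B⊆B′ B′⊆G cB′ ncB′ →
      maximal B′ sB′ B⊆B′ (biconnected⊆piece sB′ B′⊆G cB′ ncB′ (proj₁ B⊆B′ b b∈B) sb b≢c) cB′ ncB′
    where
    B⊆G : B ⊆G G
    B⊆G = (λ y → proj₁ ∘ V⁻ ∘ proj₁ B⊆piece y) , (λ y z → proj₁ ∘ E⁻ ∘ proj₂ B⊆piece y z)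

    b-other = block-has-vertex-≢ piece-simple piece-connected blockB
                (let y , y∈G , sy , y≢c = other in y , V⁺ y∈G sy , y≢c)
    b = proj₁ b-other
    b∈B = proj₁ (proj₂ b-other)
    b≢c = proj₂ (proj₂ b-other)
    sb = proj₂ (V⁻ (proj₁ B⊆piece b b∈B))

-- Paths in the block tree

module _ {A : Set} where

  Linked-lookup : ∀ {R : A → A → Set} {x xs} → Linked R (x ∷ xs)
    → ∀ i → R (List.lookup (x ∷ xs) (inject₁ i)) (List.lookup xs i)
  Linked-lookup (r ∷ _) zero = r
  Linked-lookup (_ ∷ rs) (suc i) = Linked-lookup rs i

  AllPairs-lookup : ∀ {R : A → A → Set} {xs} → (∀ {x y} → R x y → R y x) → AllPairs R xs
    → ∀ {i j} → i ≢ j → R (List.lookup xs i) (List.lookup xs j)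
  AllPairs-lookup sym (_ ∷ _) {zero} {zero} i≢j = ⊥-elim (i≢j refl)
  AllPairs-lookup sym (rx ∷ _) {zero} {suc j} _ = All.lookup rx (∈-lookup j)
  AllPairs-lookup sym (rx ∷ _) {suc i} {zero} _ = sym (All.lookup rx (∈-lookup i))
  AllPairs-lookup sym (_ ∷ rxs) {suc i} {suc j} i≢j = AllPairs-lookup sym rxs (i≢j ∘ cong suc)

  sum-tabulate-lookup : ∀ (f : A → ℕ) xs → sum (tabulate (f ∘ List.lookup xs)) ≡ sum (List.map f xs)
  sum-tabulate-lookup f xs = cong sum (trans (sym (map-tabulate (List.lookup xs) f)) (cong (List.map f) (tabulate-lookup xs)))

record Segment (n : ℕ) : Set where
  constructor segment
  field
    block : Gr n
    entry : Fin n
    width : ℕ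
open Segment

IsSegment : Gr n → Segment n → Set
IsSegment G σ = IsBlock G (block σ) × T (V (block σ) (entry σ)) × IsTd (block σ ─ entry σ) (width σ)

weight : List (Segment n) → ℕ
weight p = sum (List.map width p)

-- The path x₀ B₀ x₁ B₁ ⋯ xₘ Bₘ of the block tree, with a = x₀ and b ∈ Bₘ, is the list of
-- segments (Bᵢ, xᵢ).
data BlockWalk (G : Gr n) : Fin n → Fin n → List (Segment n) → Set where
  last : ∀ {B a t b} → IsSegment G (segment B a t) → T (V B b) → BlockWalk G a b (segment B a t ∷ [])
  through : ∀ {B a t x b p} → IsSegment G (segment B a t) → T (V B x) → IsCutvertex G x
    → BlockWalk G x b p → BlockWalk G a b (segment B a t ∷ p)

Distinct : Gr n → Gr n → Set
Distinct B B′ = ¬ (B ⊆G B′ × B′ ⊆G B)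

distinct-sym : ∀ {B B′ : Gr n} → Distinct B B′ → Distinct B′ B
distinct-sym d (B′⊆B , B⊆B′) = d (B⊆B′ , B′⊆B)

-- The endpoint b is never an entry; this is what keeps entries distinct when paths are concatenated at b.
BlockPath : Gr n → Fin n → Fin n → List (Segment n) → Set
BlockPath G a b p = BlockWalk G a b p × AllPairs (λ σ τ → Distinct (block σ) (block τ)) p
                  × AllPairs (λ σ τ → entry σ ≢ entry τ) p × All (λ σ → entry σ ≢ b) p

module _ {G : Gr n} where

  walk-entry : ∀ {a b σ p} → BlockWalk G a b (σ ∷ p) → entry σ ≡ a
  walk-entry (last _ _) = refl
  walk-entry (through _ _ _ _) = refl

  walk-segments : ∀ {a b p} → BlockWalk G a b p → All (IsSegment G) p
  walk-segments (last seg _) = seg ∷ []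
  walk-segments (through seg _ _ w) = seg ∷ walk-segments w

  walk-cutvertices : ∀ {a b σ p} → BlockWalk G a b (σ ∷ p) → All (IsCutvertex G ∘ entry) p
  walk-cutvertices (last _ _) = []
  walk-cutvertices (through _ _ cut w@(last _ _)) = cut ∷ walk-cutvertices w
  walk-cutvertices (through _ _ cut w@(through _ _ _ _)) = cut ∷ walk-cutvertices w

  walk-linked : ∀ {a b p} → BlockWalk G a b p → Linked (λ σ τ → T (V (block σ) (entry τ))) p
  walk-linked (last _ _) = [-]
  walk-linked (through _ x∈B _ w@(last _ _)) = x∈B ∷ walk-linked w
  walk-linked (through _ x∈B _ w@(through _ _ _ _)) = x∈B ∷ walk-linked w

  walk-++ : ∀ {a c b p q} → BlockWalk G a c p → IsCutvertex G c → BlockWalk G c b q → BlockWalk G a b (p ++ q)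
  walk-++ (last seg c∈B) cut w = through seg c∈B cut w
  walk-++ (through seg x∈B cutx w₁) cut w₂ = through seg x∈B cutx (walk-++ w₁ cut w₂)

walk-lift : ∀ {G₁ G : Gr n} → (∀ {B} → IsBlock G₁ B → IsBlock G B)
  → (∀ {x} → IsCutvertex G₁ x → IsCutvertex G x)
  → ∀ {a b p} → BlockWalk G₁ a b p → BlockWalk G a b p
walk-lift blk cut (last (b , a∈ , td) b∈) = last (blk b , a∈ , td) b∈
walk-lift blk cut (through (b , a∈ , td) x∈ cx w) = through (blk b , a∈ , td) x∈ (cut cx) (walk-lift blk cut w)

Within : (Fin n → Bool) → Segment n → Set
Within s σ = ∀ y → T (V (block σ) y) → T (s y)

walk-entries-within : ∀ {G : Gr n} {s a b p} → BlockWalk G a b p → All (Within s) p → All (T ∘ s ∘ entry) p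
walk-entries-within w inside = All.zipWith (λ (in-s , _ , e∈ , _) → in-s _ e∈) (inside , walk-segments w)

-- The blocks on the first side must not be the single vertex c: this is where their distinctness
-- from the blocks on the second side comes from.
path-++ : ∀ {G : Gr n} {s₁ s₂ : Fin n → Bool} {c a b p q}
  → (∀ {y} → T (s₁ y) → T (s₂ y) → y ≡ c) → IsCutvertex G c
  → BlockPath G a c p → All (Within s₁) p → All (λ σ → ∃[ y ] T (V (block σ) y) × y ≢ c) p
  → BlockPath G c b q → All (Within s₂) q → T (s₂ b) → b ≢ c
  → BlockPath G a b (p ++ q)
path-++ {s₁ = s₁} {s₂} {b = b} {p} {q} meet cut
        (wp , Dp , Ep , Np) inside₁ others (wq , Dq , Eq , Nq) inside₂ b∈s₂ b≢c =
  walk-++ wp cut wq , AllPairsₚ.++⁺ Dp Dq blocks-apart , AllPairsₚ.++⁺ Ep Eq entries-apart , Allₚ.++⁺ b-not-entry Nq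
  where
  entries₁ = walk-entries-within wp inside₁
  entries₂ = walk-entries-within wq inside₂

  blocks-apart : All (λ σ → All (λ τ → Distinct (block σ) (block τ)) q) p
  blocks-apart = All.zipWith
    (λ (in₁ , y , y∈ , y≢c) → All.map (λ in₂ (B⊆B′ , _) → y≢c (meet (in₁ y y∈) (in₂ y (proj₁ B⊆B′ y y∈)))) inside₂)
    (inside₁ , others)

  entries-apart : All (λ σ → All (λ τ → entry σ ≢ entry τ) q) p
  entries-apart = All.zipWith
    (λ (e₁∈ , e≢c) → All.map (λ e₂∈ e≡e → e≢c (meet e₁∈ (subst (T ∘ s₂) (sym e≡e) e₂∈))) entries₂)
    (entries₁ , Np)

  b-not-entry : All (λ σ → entry σ ≢ b) p
  b-not-entry = All.map (λ e₁∈ e≡b → b≢c (meet (subst (T ∘ s₁) e≡b e₁∈) b∈s₂)) entries₁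

path-lift : ∀ {G₁ G : Gr n} → (∀ {B} → IsBlock G₁ B → IsBlock G B)
  → (∀ {x} → IsCutvertex G₁ x → IsCutvertex G x)
  → ∀ {a b p} → BlockPath G₁ a b p → BlockPath G a b p
path-lift blk cut (w , rest) = walk-lift blk cut w , rest

path-within : ∀ (G : Gr n) s {a b p} → BlockPath (induced G s) a b p → All (Within s) p
path-within G s (w , _) =
  All.map (λ (blk , _) y y∈ → proj₂ (Induced.V⁻ G s (proj₁ (proj₁ (proj₂ blk)) y y∈))) (walk-segments w)

weight-++ : ∀ (p q : List (Segment n)) → weight (p ++ q) ≡ weight p + weight q
weight-++ p q = trans (cong sum (map-++ width p q)) (sum-++ (List.map width p) (List.map width q))

-- The induction

PathsBound : (G : Gr n) (x₀ : Fin n) → ElimForest (G ─ x₀) → Set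
PathsBound G x₀ F = ∀ v → T (V (G ─ x₀) v) → ∃[ p ] BlockPath G x₀ v p × depth F v ≤ weight p

hasCutvertex? : (G : Gr n) → Dec (HasCutvertex G)
hasCutvertex? G = any? λ x → T? (V G x) ×-dec any? λ u → any? λ v →
  T? (V (G ─ x) u) ×-dec T? (V (G ─ x) v) ×-dec ¬? (reach? (G ─ x) u v)

biconnected⇒block : ∀ {G : Gr n} → IsSimple G → Connected G → ¬ HasCutvertex G → IsBlock G G
biconnected⇒block sG cG noCut = sG , ((λ _ → id) , (λ _ _ → id)) , cG , noCut , λ _ _ _ B′⊆G _ _ → B′⊆G

block-case : ∀ {G : Gr n} → IsSimple G → Connected G → ¬ HasCutvertex G
  → ∀ {x₀} → T (V G x₀) → Σ (ElimForest (G ─ x₀)) (PathsBound G x₀)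
block-case {G = G} sG cG noCut {x₀} x₀∈ = F , paths
  where
  optimal = treedepth-exists (G ─ x₀) (simple⇒edgesOnVertices (─-simple x₀ sG))
  t = proj₁ optimal
  F = proj₁ (proj₁ (proj₂ optimal))

  paths : PathsBound G x₀ F
  paths v v∈ =
    let v∈G , v≢x₀ = Deletion.V⁻ G x₀ v∈ in
    segment G x₀ t ∷ [] ,
    (last (biconnected⇒block sG cG noCut , x₀∈ , proj₂ optimal) v∈G ,
     [] ∷ [] , [] ∷ [] , (v≢x₀ ∘ sym) ∷ []) ,
    ≤-trans (proj₂ (proj₁ (proj₂ optimal)) v v∈) (m≤m+n t 0)

-- G is split at the cutvertex c into the piece G₁ containing the component of r in G ─ c and the
-- piece G₂ containing the rest (in particular z); both contain c.
module AtCutvertex {G : Gr n} (sG : IsSimple G) (cG : Connected G) {c : Fin n} (cut : IsCutvertex G c)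
  {r z : Fin n} (r∈ : T (V (G ─ c) r)) (z∈ : T (V (G ─ c) z)) (r↛z : ¬ Reach (G ─ c) r z)
  (recurse : ∀ (H : Gr n) → size (V H) < size (V G) → IsSimple H → Connected H
           → ∀ {x} → T (V H x) → Σ (ElimForest (H ─ x)) (PathsBound H x))
  where

  private
    c∈G = proj₁ cut
    r∈G = proj₁ (Deletion.V⁻ G c r∈)
    r≢c = proj₂ (Deletion.V⁻ G c r∈)
    z∈G = proj₁ (Deletion.V⁻ G c z∈)
    z≢c = proj₂ (Deletion.V⁻ G c z∈)

    from-c : ∀ {y} → Reach (G ─ c) c y → y ≡ c
    from-c here = refl
    from-c (step e _) = ⊥-elim (proj₁ (proj₂ (Deletion.E⁻ G c e)) refl)

    side₁? : ∀ y → Dec (Reach (G ─ c) r y ⊎ y ≡ c)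
    side₁? y = reach? (G ─ c) r y ⊎-dec y ≟ c

    side₂? : ∀ y → Dec (¬ Reach (G ─ c) r y ⊎ y ≡ c)
    side₂? y = ¬? (reach? (G ─ c) r y) ⊎-dec y ≟ c

    s₁ s₂ : Fin n → Bool
    s₁ y = ⌊ side₁? y ⌋
    s₂ y = ⌊ side₂? y ⌋

    closed₁ : ∀ {y y′} → Reach (G ─ c) y y′ → T (s₁ y) → T (s₁ y′)
    closed₁ {y} yy′ p = fromWitness (case toWitness {a? = side₁? y} p of λ where
      (inj₁ ry) → inj₁ (reach-trans ry yy′)
      (inj₂ refl) → inj₂ (from-c yy′))

    closed₂ : ∀ {y y′} → Reach (G ─ c) y y′ → T (s₂ y) → T (s₂ y′)
    closed₂ {y} yy′ p = fromWitness (case toWitness {a? = side₂? y} p of λ where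
      (inj₁ r↛y) → inj₁ (λ ry′ → r↛y (reach-trans ry′ (reach-sym (simple⇒E-symmetric (─-simple c sG)) yy′)))
      (inj₂ refl) → inj₂ (from-c yy′))

    meet : ∀ {y} → T (s₁ y) → T (s₂ y) → y ≡ c
    meet {y} p q with toWitness {a? = side₁? y} p | toWitness {a? = side₂? y} q
    ... | inj₂ y≡c | _ = y≡c
    ... | inj₁ _ | inj₂ y≡c = y≡c
    ... | inj₁ ry | inj₁ r↛y = ⊥-elim (r↛y ry)

    outside₁ : ∀ {y} → ¬ T (s₁ y) → T (s₂ y) × y ≢ c
    outside₁ {y} ¬p = fromWitness (inj₁ (¬p ∘ fromWitness ∘ inj₁)) , ¬p ∘ fromWitness {a? = side₁? y} ∘ inj₂

    c∈s₁ : T (s₁ c)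
    c∈s₁ = fromWitness (inj₂ refl)

    z∉s₁ : ¬ T (s₁ z)
    z∉s₁ p = case toWitness {a? = side₁? z} p of λ where
      (inj₁ rz) → r↛z rz
      (inj₂ z≡c) → z≢c z≡c

    c∈s₂ : T (s₂ c)
    c∈s₂ = fromWitness (inj₂ refl)

    r∈s₁ : T (s₁ r)
    r∈s₁ = fromWitness (inj₁ here)

    module P₁ = Piece sG cG c∈G s₁ c∈s₁ closed₁ (r , r∈G , r∈s₁ , r≢c)
    module P₂ = Piece sG cG c∈G s₂ c∈s₂ closed₂ (z , z∈G , proj₁ (outside₁ z∉s₁) , z≢c)

    G₁ = P₁.piece
    G₂ = P₂.piece

    smaller₁ : size (V G₁) < size (V G)
    smaller₁ = size-strict (λ _ → proj₁ ∘ P₁.V⁻) z z∈G (z∉s₁ ∘ proj₂ ∘ P₁.V⁻)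

    smaller₂ : size (V G₂) < size (V G)
    smaller₂ = size-strict (λ _ → proj₁ ∘ P₂.V⁻) r r∈G (r≢c ∘ meet r∈s₁ ∘ proj₂ ∘ P₂.V⁻)

    lift₁ : ∀ {a b p} → BlockPath G₁ a b p → BlockPath G a b p
    lift₁ = path-lift P₁.block-lift P₁.cutvertex-lift

    lift₂ : ∀ {a b p} → BlockPath G₂ a b p → BlockPath G a b p
    lift₂ = path-lift P₂.block-lift P₂.cutvertex-lift

    outside₁⇒G₂ : ∀ {y} → T (V G y) → ¬ T (s₁ y) → T (V (G₂ ─ c) y)
    outside₁⇒G₂ y∈G ¬s₁y = let s₂y , y≢c = outside₁ ¬s₁y in P₂.piece-─⁺ y∈G s₂y y≢c

    R₂ = recurse G₂ smaller₂ P₂.piece-simple P₂.piece-connected P₂.c∈piece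
    F₂ = proj₁ R₂

    ends₂ : EdgesOnVertices (G₂ ─ c)
    ends₂ = simple⇒edgesOnVertices (─-simple c P₂.piece-simple)

    -- For x on the first side, G ─ x consists of G₁ ─ x and G₂ ─ c, joined only by edges at c.
    module Halves {x : Fin n} (x∈s₁ : T (s₁ x)) where

      V₁⊆V : ∀ {y} → T (V (G₁ ─ x) y) → T (V (G ─ x) y)
      V₁⊆V y∈ = let y∈G , _ , y≢x = P₁.piece-─⁻ y∈ in Deletion.V⁺ G x y∈G y≢x

      V₂⊆V∖V₁ : ∀ {y} → T (V (G₂ ─ c) y) → T (V (G ─ x) y) × ¬ T (V (G₁ ─ x) y)
      V₂⊆V∖V₁ y∈ =
        let y∈G , s₂y , y≢c = P₂.piece-─⁻ y∈
            ¬s₁y = λ s₁y → y≢c (meet s₁y s₂y)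
        in Deletion.V⁺ G x y∈G (λ { refl → ¬s₁y x∈s₁ }) , ¬s₁y ∘ proj₁ ∘ proj₂ ∘ P₁.piece-─⁻

      V∖V₁⊆V₂ : ∀ {y} → T (V (G ─ x) y) → ¬ T (V (G₁ ─ x) y) → T (V (G₂ ─ c) y)
      V∖V₁⊆V₂ y∈ y∉₁ = let y∈G , y≢x = Deletion.V⁻ G x y∈ in
        outside₁⇒G₂ y∈G (λ s₁y → y∉₁ (P₁.piece-─⁺ y∈G s₁y y≢x))

      edge-halves : ∀ u w → T (E (G ─ x) u w)
        → T (E (G₁ ─ x) u w) ⊎ T (E (G₂ ─ c) u w)
        ⊎ (u ≡ c × T (V (G₂ ─ c) w)) ⊎ (w ≡ c × T (V (G₂ ─ c) u))
      edge-halves u w e with Deletion.E⁻ G x e | T? (s₁ u) | T? (s₁ w)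
      ... | e′ , u≢x , w≢x | yes s₁u | yes s₁w = inj₁ (P₁.piece-─-E⁺ e′ s₁u s₁w u≢x w≢x)
      ... | e′ , _ , _ | no ¬s₁u | no ¬s₁w =
        let s₂u , u≢c = outside₁ ¬s₁u ; s₂w , w≢c = outside₁ ¬s₁w in
        inj₂ (inj₁ (P₂.piece-─-E⁺ e′ s₂u s₂w u≢c w≢c))
      ... | e′ , _ , _ | yes s₁u | no ¬s₁w =
        inj₂ (inj₂ (inj₁ (P₁.leaves-at-c u w e′ s₁u ¬s₁w ,
                          outside₁⇒G₂ (proj₂ (simple⇒edgesOnVertices sG u w e′)) ¬s₁w)))
      ... | e′ , _ , _ | no ¬s₁u | yes s₁w =
        inj₂ (inj₂ (inj₂ (P₁.enters-at-c u w e′ ¬s₁u s₁w ,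
                          outside₁⇒G₂ (proj₁ (simple⇒edgesOnVertices sG u w e′)) ¬s₁u)))

  at-c : Σ (ElimForest (G ─ c)) (PathsBound G c)
  at-c = J.forest , paths
    where
    open Halves c∈s₁
    R₁ = recurse G₁ smaller₁ P₁.piece-simple P₁.piece-connected P₁.c∈piece

    edges : ∀ u w → T (E (G ─ c) u w) → EdgeSplit (G₁ ─ c) (G₂ ─ c) nothing u w
    edges u w e with edge-halves u w e
    ... | inj₁ e₁ = inj₁ e₁
    ... | inj₂ (inj₁ e₂) = inj₂ (inj₁ e₂)
    ... | inj₂ (inj₂ (inj₁ (refl , _))) = ⊥-elim (proj₁ (proj₂ (Deletion.E⁻ G c e)) refl)
    ... | inj₂ (inj₂ (inj₂ (refl , _))) = ⊥-elim (proj₂ (proj₂ (Deletion.E⁻ G c e)) refl)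

    module J = Graft (proj₁ R₁) F₂ (simple⇒edgesOnVertices (─-simple c P₁.piece-simple)) ends₂
                 V₁⊆V V₂⊆V∖V₁ V∖V₁⊆V₂ nothing (λ ()) edges

    paths : PathsBound G c J.forest
    paths v v∈ with T? (V (G₁ ─ c) v)
    ... | yes v∈₁ = let p , path , bound = proj₂ R₁ v v∈₁ in
                    p , lift₁ path , subst (_≤ weight p) (sym (J.depth-on₁ v∈₁)) bound
    ... | no v∉₁ = let v∈₂ = V∖V₁⊆V₂ v∈ v∉₁ ; p , path , bound = proj₂ R₂ v v∈₂ in
                   p , lift₂ path , subst (_≤ weight p) (sym (J.depth-on₂ v∈₂)) bound

  at-r : Σ (ElimForest (G ─ r)) (PathsBound G r)
  at-r = J.forest , paths
    where
    open Halves r∈s₁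
    R₁ = recurse G₁ smaller₁ P₁.piece-simple P₁.piece-connected (P₁.V⁺ r∈G r∈s₁)
    F₁ = proj₁ R₁

    c∈G₁-r : T (V (G₁ ─ r) c)
    c∈G₁-r = P₁.piece-─⁺ c∈G c∈s₁ (r≢c ∘ sym)

    edges : ∀ u w → T (E (G ─ r) u w) → EdgeSplit (G₁ ─ r) (G₂ ─ c) (just c) u w
    edges u w e = Sum.map₂ (Sum.map₂ (Sum.map (Product.map₁ (cong just ∘ sym)) (Product.map₁ (cong just ∘ sym))))
                           (edge-halves u w e)

    anchor∈G₁-r : ∀ {a} → just c ≡ just a → T (V (G₁ ─ r) a)
    anchor∈G₁-r refl = c∈G₁-r

    module J = Graft F₁ F₂ (simple⇒edgesOnVertices (─-simple r P₁.piece-simple)) ends₂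
                 V₁⊆V V₂⊆V∖V₁ V∖V₁⊆V₂ (just c) anchor∈G₁-r edges

    paths : PathsBound G r J.forest
    paths v v∈ with T? (V (G₁ ─ r) v)
    ... | yes v∈₁ = let p , path , bound = proj₂ R₁ v v∈₁ in
                    p , lift₁ path , subst (_≤ weight p) (sym (J.depth-on₁ v∈₁)) bound
    ... | no v∉₁ =
      let v∈₂ = V∖V₁⊆V₂ v∈ v∉₁
          _ , s₂v , v≢c = P₂.piece-─⁻ v∈₂
          p₁ , path₁ , bound₁ = proj₂ R₁ c c∈G₁-r
          p₂ , path₂ , bound₂ = proj₂ R₂ v v∈₂
          others = All.map (λ (blk , _) → block-has-vertex-≢ sG cG blk (r , r∈G , r≢c))
                           (walk-segments (proj₁ (lift₁ path₁)))
      in p₁ ++ p₂ ,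
         path-++ meet cut (lift₁ path₁) (path-within G s₁ path₁) others
                          (lift₂ path₂) (path-within G s₂ path₂) s₂v v≢c ,
         (begin
           depth J.forest v               ≡⟨ J.depth-on₂ v∈₂ ⟩
           depth F₁ c + depth F₂ v        ≤⟨ +-mono-≤ bound₁ bound₂ ⟩
           weight p₁ + weight p₂          ≡⟨ weight-++ p₁ p₂ ⟨
           weight (p₁ ++ p₂)              ∎)
      where open ≤-Reasoning

forest-with-paths : (G : Gr n) → Acc _<_ (size (V G)) → IsSimple G → Connected G
  → ∀ {x₀} → T (V G x₀) → Σ (ElimForest (G ─ x₀)) (PathsBound G x₀)
forest-with-paths G (acc smaller) sG cG {x₀} x₀∈ = split (hasCutvertex? G)
  where
  recurse : ∀ (H : Gr _) → size (V H) < size (V G) → IsSimple H → Connected H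
    → ∀ {x} → T (V H x) → Σ (ElimForest (H ─ x)) (PathsBound H x)
  recurse H H<G = forest-with-paths H (smaller H<G)

  split : Dec (HasCutvertex G) → Σ (ElimForest (G ─ x₀)) (PathsBound G x₀)
  split (no noCut) = block-case sG cG noCut x₀∈
  split (yes (c , cut@(_ , u , w , u∈ , w∈ , u↛w))) with x₀ ≟ c
  ... | yes refl = AtCutvertex.at-c sG cG cut u∈ w∈ u↛w recurse
  ... | no x₀≢c with reach? (G ─ c) x₀ u
  ...   | yes x₀u = AtCutvertex.at-r sG cG cut (Deletion.V⁺ G c x₀∈ x₀≢c) w∈
                      (λ x₀w → u↛w (reach-trans (reach-sym (simple⇒E-symmetric (─-simple c sG)) x₀u) x₀w)) recurse
  ...   | no x₀↛u = AtCutvertex.at-r sG cG cut (Deletion.V⁺ G c x₀∈ x₀≢c) u∈ x₀↛u recurse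

deepest-vertex : ∀ {H : Gr n} (F : ElimForest H) → ∃[ v ] T (V H v) → ∃[ v ] T (V H v) × HeightAtMost F (depth F v)
deepest-vertex {n = n} {H} F (v₀ , v₀∈) =
  argmax (depth F) v₀ vertices ,
  argmax-all (depth F) v₀∈ (all-filter (T? ∘ V H) (allFin n)) ,
  λ w w∈ → v≤f[argmax]⁺ v₀ vertices
              (inj₂ (Any.map (λ { refl → ≤-refl }) (∈-filter⁺ (T? ∘ V H) (∈-allFin w) w∈)))
  where
  vertices = List.filter (T? ∘ V H) (allFin n)

vertex-besides : ∀ {G : Gr n} {u v} → T (V G u) → T (V G v) → u ≢ v → ∀ x → ∃[ y ] T (V (G ─ x) y)
vertex-besides {G = G} {u} {v} u∈ v∈ u≢v x with u ≟ x
... | yes refl = v , Deletion.V⁺ G u v∈ (u≢v ∘ sym)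
... | no u≢x = u , Deletion.V⁺ G x u∈ u≢x

lemma3 : ∀ {n} (G : Gr n) → IsSimple G → Connected G
    → (∃[ u ] ∃[ v ] (T (V G u) × T (V G v) × u ≢ v))
    → (x₀ : Fin n) → T (V G x₀)
    → ∃[ m ] Σ (Fin (suc m) → Gr n) λ B → Σ (Fin (suc m) → Fin n) λ x →
        (x zero ≡ x₀)
      × (∀ i → IsBlock G (B i))
      × (∀ (i : Fin m) → IsCutvertex G (x (suc i)))
      × (∀ (i : Fin m) → T (V (B (inject₁ i)) (x (suc i))) × T (V (B (suc i)) (x (suc i))))
      × (∀ i j → i ≢ j → ¬ (B i ⊆G B j × B j ⊆G B i))
      × (∀ (i j : Fin m) → i ≢ j → x (suc i) ≢ x (suc j))
      × T (V (B zero) x₀)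
      × Σ (Fin (suc m) → ℕ) λ t → Σ ℕ λ s →
          (∀ i → IsTd (B i ─ x i) (t i)) × IsTd (G ─ x₀) s × s ≤ sum (tabulate t)
lemma3 G sG cG (u , v , u∈ , v∈ , u≢v) x₀ x₀∈ with forest-with-paths G (<-wellFounded _) sG cG x₀∈
... | F , paths with deepest-vertex F (vertex-besides {G = G} u∈ v∈ u≢v x₀)
... | w , w∈ , deepest with paths w w∈ | treedepth-exists (G ─ x₀) (simple⇒edgesOnVertices (─-simple x₀ sG))
... | [] , (() , _) , _ | _
... | σ ∷ τ , (walk , blocks-distinct , _ ∷ cuts-distinct , _) , depth≤weight | s , td =
  List.length τ , block ∘ List.lookup (σ ∷ τ) , entry ∘ List.lookup (σ ∷ τ) ,
  walk-entry walk ,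
  proj₁ ∘ segment-at ,
  (λ i → All.lookup (walk-cutvertices walk) (∈-lookup i)) ,
  (λ i → Linked-lookup (walk-linked walk) i , proj₁ (proj₂ (segment-at (suc i)))) ,
  (λ i j → AllPairs-lookup distinct-sym blocks-distinct) ,
  (λ i j → AllPairs-lookup ≢-sym cuts-distinct) ,
  subst (T ∘ V (block σ)) (walk-entry walk) (proj₁ (proj₂ (segment-at zero))) ,
  width ∘ List.lookup (σ ∷ τ) , s , proj₂ ∘ proj₂ ∘ segment-at , td ,
  ≤-trans (proj₂ td F _ deepest) (subst (depth F w ≤_) (sym (sum-tabulate-lookup width (σ ∷ τ))) depth≤weight)
  where
  segment-at : ∀ i → IsSegment G (List.lookup (σ ∷ τ) i)
  segment-at i = All.lookup (walk-segments walk) (∈-lookup i)
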